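{- Let $A$ be a sincere Nakayama algebra with $n$ simple modules. Then $A$ has finite global dimension if and only if $A$ has a unique indecomposable projective module of $K$-dimension $n$. Moreover, the map sending the Kupisch series $[c_0,\dots,c_{n-1}]$ of a sincere Nakayama algebra $A$ of finite global dimension with $n$ simple modules, rotated so that $c_0=n$, to the Dyck path $D$ with area sequence \[ [c_1-n+1,\;c_2-n+1,\;\dots,\;c_{n-1}-n+1,\;1] \] is a bijection between (isomorphism classes of) sincere Nakayama algebras of finite global dimension with $n$ simple modules and Dyck paths of semilength $n-1$. Furthermore, in this case \[ \operatorname{gldim}A = 2\cdot b_D, \] where $b_D$ is the bounce count of $D$.
   Context: $K$ is an algebraically closed field; a (connected) Nakayama algebra with $n$ simple modules is $KQ/I$, $I$ admissible, with $Q$ the linear quiver $0\to\cdots\to n-1$ or the cyclic quiver $0\to1\to\cdots\to n-1\to0$; its Kupisch series is $[c_0,\dots,c_{n-1}]$, $c_i=\dim_K e_iA$, which determines $A$ up to isomorphism (up to cyclic rotation in the cyclic case). $A$ is sincere if every indecomposable projective $A$-module has every simple $A$-module as a composition factor. A Dyck path of semilength $k$ is a lattice path from $(0,0)$ to $(2k,0)$ with steps $(1,1)$, $(1,-1)$ never going below the $x$-axis. Its area sequence is $[a_0,\dots,a_k]$ where $a_j$ is the largest integer such that $(2j+a_j-1,a_j-1)$ lies on the path; area sequences of Dyck paths of semilength $k$ are exactly the sequences with $a_{j+1}+1\ge a_j\ge 2$ for $0\le j\le k-1$ and $a_k=1$. The bounce points are defined by $b_0=0$ and $b_{t+1}=b_t+a_{b_t}-1$;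 they strictly increase until $b_d=k$, and the bounce count $b_D$ is this number $d$ of steps. -}

module Defs where

open import Data.Nat using (ℕ; zero; suc; _+_; _*_; _∸_; _≤_; _<_)
open import Data.Nat.DivMod using (_mod_)
open import Data.Fin using (Fin; toℕ)
open import Data.Vec using (Vec; lookup)
open import Data.List using (List; []; _∷_; length)
open import Data.Integer using (ℤ; +_; -_; 0ℤ; 1ℤ) renaming (_+_ to _+ℤ_; _≤_ to _≤ℤ_)
open import Data.Product using (Σ; ∃; _×_; _,_)
open import Data.Sum using (_⊎_)
open import Data.Empty using (⊥)
open import Relation.Binary.PropositionalEquality using (_≡_)

-- Nakayama algebras with n = suc m simple modules, given by their
-- quiver type and Kupisch series [c_0, …, c_{n-1}].

data QuiverType : Set where
  linear cyclic : QuiverType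

kupAt : ∀ {m} → Vec ℕ (suc m) → ℕ → ℕ
kupAt {m} c i = lookup c (i mod (suc m))

-- Kupisch series of an admissible quotient of the linear / cyclic quiver
ValidKupisch : ∀ {m} → QuiverType → Vec ℕ (suc m) → Set
ValidKupisch {m} linear c =
  ((i : Fin (suc m)) → toℕ i < m →
     (2 ≤ lookup c i) × (lookup c i ≤ suc (kupAt c (suc (toℕ i)))))
  × (kupAt c m ≡ 1)
ValidKupisch {m} cyclic c =
  (i : Fin (suc m)) →
     (2 ≤ lookup c i) × (lookup c i ≤ suc (kupAt c (suc (toℕ i))))

record Nakayama (m : ℕ) : Set where
  field
    kind    : QuiverType
    kupisch : Vec ℕ (suc m)
    valid   : ValidKupisch kind kupisch

open Nakayama public

-- dim_K e_i A (index modulo n)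
c[_] : ∀ {m} → Nakayama m → ℕ → ℕ
c[ A ] i = kupAt (kupisch A) i

Iso : ∀ {m} → Nakayama m → Nakayama m → Set
Iso A B =
  (kind A ≡ linear × kind B ≡ linear × kupisch A ≡ kupisch B)
  ⊎ (kind A ≡ cyclic × kind B ≡ cyclic ×
       ∃ λ (r : ℕ) → (i : ℕ) → c[ A ] (r + i) ≡ c[ B ] i)

-- the simple S_j is a composition factor of the indecomposable projective
-- e_i A (whose composition factors are S_i, S_{i+1}, …, S_{i+c_i-1}, mod n)
CompFactor : ∀ {m} → Nakayama m → Fin (suc m) → Fin (suc m) → Set
CompFactor {m} A i j =
  ∃ λ k → (k < lookup (kupisch A) i) × (((toℕ i + k) mod (suc m)) ≡ j)

Sincere : ∀ {m} → Nakayama m → Set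
Sincere {m} A = (i j : Fin (suc m)) → CompFactor A i j

UniqueProjOfDim : ∀ {m} → Nakayama m → ℕ → Set
UniqueProjOfDim {m} A d =
  Σ (Fin (suc m)) λ i → (lookup (kupisch A) i ≡ d) ×
     ((j : Fin (suc m)) → lookup (kupisch A) j ≡ d → j ≡ i)

-- Indecomposable modules are uniserial: M(i,l) = e_i A / e_i J^l with
-- 1 ≤ l ≤ c_i. Its projective cover is e_i A = M(i,c_i) and its first
-- syzygy is 0 if l = c_i, and M(i+l, c_i - l) otherwise.
-- PdLe A d i l  :⇔  pd M(i,l) ≤ d.

PdLe : ∀ {m} → Nakayama m → ℕ → ℕ → ℕ → Set
PdLe A zero    i l = l ≡ c[ A ] i
PdLe A (suc d) i l = (l ≡ c[ A ] i) ⊎ PdLe A d (i + l) (c[ A ] i ∸ l)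

-- every (finitely generated) module has projective dimension ≤ d;
-- enough to check on the finitely many indecomposables
AllPdLe : ∀ {m} → Nakayama m → ℕ → Set
AllPdLe {m} A d = (i : Fin (suc m)) (l : ℕ) → 1 ≤ l → l ≤ c[ A ] (toℕ i) →
  PdLe A d (toℕ i) l

FiniteGlDim : ∀ {m} → Nakayama m → Set
FiniteGlDim A = ∃ λ d → AllPdLe A d

GlDimIs : ∀ {m} → Nakayama m → ℕ → Set
GlDimIs A g = AllPdLe A g × ((d : ℕ) → AllPdLe A d → g ≤ d)

data Step : Set where
  up down : Step

stepℤ : Step → ℤ
stepℤ up   = 1ℤ
stepℤ down = - 1ℤ

heightAt : List Step → ℕ → ℤ
heightAt []       _       = 0ℤ
heightAt (s ∷ p)  zero    = 0ℤ
heightAt (s ∷ p)  (suc t) = stepℤ s +ℤ heightAt p t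

OnPath : List Step → ℕ → ℕ → Set
OnPath p x y = (x ≤ length p) × (heightAt p x ≡ + y)

record DyckPath (k : ℕ) : Set where
  field
    steps       : List Step
    len         : length steps ≡ 2 * k
    nonneg      : (t : ℕ) → t ≤ 2 * k → 0ℤ ≤ℤ heightAt steps t
    endsAtZero  : heightAt steps (2 * k) ≡ 0ℤ

open DyckPath public

-- a_j = a : a is the largest integer with (2j + a - 1, a - 1) on the path
AreaEntry : ∀ {k} → DyckPath k → ℕ → ℕ → Set
-- a = 0 would need the point (2j-1,-1), which never lies on a path in ℕ²
AreaEntry D j zero    = ⊥
AreaEntry D j (suc b) = OnPath (steps D) (2 * j + b) b ×
  ((b' : ℕ) → OnPath (steps D) (2 * j + b') b' → b' ≤ b)

-- a is the area sequence [a_0, …, a_k] of D (values beyond k irrelevant)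
IsAreaSeq : ∀ {k} → DyckPath k → (ℕ → ℕ) → Set
IsAreaSeq {k} D a = (j : ℕ) → j ≤ k → AreaEntry D j (a j)

BounceCountOf : ℕ → (ℕ → ℕ) → ℕ → Set
BounceCountOf k a d =
  ∃ λ (b : ℕ → ℕ) → (b 0 ≡ 0) ×
    ((t : ℕ) → t < d → (b t < k) × (b (suc t) ≡ b t + a (b t) ∸ 1)) ×
    (b d ≡ k)

BounceCount : ∀ {k} → DyckPath k → ℕ → Set
BounceCount {k} D d = ∃ λ a → IsAreaSeq D a × BounceCountOf k a d

Corresponds : ∀ {m} → Nakayama m → DyckPath m → Set
Corresponds {m} A D =
  ∃ λ (r : Fin (suc m)) → (lookup (kupisch A) r ≡ suc m) ×
    ((j : ℕ) → j < m → AreaEntry D j (c[ A ] (toℕ r + suc j) ∸ suc m + 1)) ×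
    AreaEntry D m 1

-- For a sincere Nakayama algebra every c_i ≥ n, and the uniserial module
-- M(i, l) = e_i A / e_i J^l has syzygy M(i + l, c_i − l). If no c_i equals n,
-- or if two of them do, an explicit family of non-projective modules is
-- closed under syzygies, so the global dimension is infinite.
--
-- If e_ρ A is the unique projective of dimension n, describe a module by the
-- segment [s, t) of its composition factors S_{ρ+s}, …, S_{ρ+t−1} and put
-- C y = c_{ρ+y}, H y = y + C y − n. The projective cover of [s, t) is
-- [s, n + H s), so the second syzygy of [s, t) is [H s, H t) moved by one
-- period. H is monotone, fixes 0 and n and moves every 0 < y < n up, hence
-- gldim A = 2d for the least d with H^d 1 = n. The numbers C (j + 1) − n are
-- a_j − 1 for an area sequence a; a Dyck path is determined by, and can be
-- built from, its area sequence, and H^t 1 = b_t + 1 for its bounce points.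
module Submission where

open import Defs
open import Data.Nat using (ℕ; zero; suc; _+_; _*_; _∸_; _≤_; _<_; _≟_; _≤?_; _<?_; z≤n; s≤s; z<s; NonZero)
open import Data.Nat.Properties
open import Data.Nat.DivMod
open import Data.Nat.GeneralisedArithmetic using (iterate; iterate-is-fold)
open import Algebra.Properties.CommutativeSemigroup +-commutativeSemigroup using (x∙yz≈y∙xz; xy∙z≈xz∙y)
import Data.Integer as ℤ
open import Data.Integer using (_⊖_; 0ℤ; +≤+) renaming (_+_ to _+ℤ_; _≤_ to _≤ℤ_; _<_ to _<ℤ_)
import Data.Integer.Properties as ℤ
open import Data.Fin using (Fin; toℕ) renaming (zero to fzero; suc to fsuc)
open import Data.Fin.Properties using (toℕ-injective; toℕ<n; toℕ-fromℕ<; fromℕ<-cong; any?)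
open import Data.Vec using (Vec; lookup; tabulate; []; _∷_)
open import Data.Vec.Properties using (lookup∘tabulate)
open import Data.List using (List; []; _∷_; length; applyUpTo)
open import Data.List.Properties using (length-applyUpTo)
open import Data.Product using (Σ; ∃; _×_; _,_; proj₁; proj₂)
open import Data.Sum as Sum using (_⊎_; inj₁; inj₂)
open import Data.Empty using (⊥; ⊥-elim)
open import Relation.Nullary using (¬_; yes; no)
open import Relation.Unary using (Decidable)
open import Relation.Binary.PropositionalEquality
open import Relation.Binary.Definitions using (tri<; tri≈; tri>)
open import Function.Bundles using (_⇔_; mk⇔; Equivalence)

-- Lattice paths

0≤⊖⇒≤ : ∀ {m n} → 0ℤ ≤ℤ m ⊖ n → n ≤ m
0≤⊖⇒≤ {m} {n} 0≤ = ≮⇒≥ λ m<n →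
  ℤ.<⇒≱ (subst (m ⊖ n <ℤ_) (ℤ.n⊖n≡0 m) (ℤ.⊖-monoʳ->-< m m<n)) 0≤

⊖≡+⇒ : ∀ {m n y} → m ⊖ n ≡ ℤ.+ y → m ≡ y + n
⊖≡+⇒ {m} {n} eq =
  trans (sym (m∸n+n≡m n≤m)) (cong (_+ n) (ℤ.+-injective (trans (sym (ℤ.⊖-≥ n≤m)) eq)))
  where
  n≤m : n ≤ m
  n≤m = 0≤⊖⇒≤ (subst (0ℤ ≤ℤ_) (sym eq) (+≤+ z≤n))

isDown : Step → ℕ
isDown up   = 0
isDown down = 1

isDown-injective : ∀ {s s′} → isDown s ≡ isDown s′ → s ≡ s′
isDown-injective {up}   {up}   _ = refl
isDown-injective {down} {down} _ = refl

downs : List Step → ℕ → ℕ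
downs _       zero    = 0
downs []      (suc t) = 0
downs (s ∷ p) (suc t) = isDown s + downs p t

heightAt≡⊖downs : ∀ p t → t ≤ length p → heightAt p t ≡ t ⊖ 2 * downs p t
heightAt≡⊖downs []         zero    _         = refl
heightAt≡⊖downs (s ∷ p)    zero    _         = refl
heightAt≡⊖downs (up ∷ p)   (suc t) (s≤s t≤p) =
  trans (cong (stepℤ up +ℤ_) (heightAt≡⊖downs p t t≤p)) (ℤ.distribʳ-⊖-+-pos 1 t (2 * downs p t))
heightAt≡⊖downs (down ∷ p) (suc t) (s≤s t≤p) = begin
  stepℤ down +ℤ heightAt p t  ≡⟨ cong (stepℤ down +ℤ_) (heightAt≡⊖downs p t t≤p) ⟩
  stepℤ down +ℤ (t ⊖ 2 * d)   ≡⟨ ℤ.distribʳ-⊖-+-neg 0 t (2 * d) ⟩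
  t ⊖ suc (2 * d)             ≡⟨ ℤ.[1+m]⊖[1+n]≡m⊖n t (suc (2 * d)) ⟨
  suc t ⊖ (2 + 2 * d)         ≡⟨ cong (suc t ⊖_) (*-suc 2 d) ⟨
  suc t ⊖ 2 * suc d           ∎
  where
  open ≡-Reasoning
  d : ℕ
  d = downs p t

downs-suc-≥ : ∀ p t → downs p t ≤ downs p (suc t)
downs-suc-≥ p       zero    = z≤n
downs-suc-≥ []      (suc t) = z≤n
downs-suc-≥ (s ∷ p) (suc t) = +-monoʳ-≤ (isDown s) (downs-suc-≥ p t)

downs-suc-≤ : ∀ p t → downs p (suc t) ≤ suc (downs p t)
downs-suc-≤ []         t       = z≤n
downs-suc-≤ (up ∷ p)   zero    = z≤n
downs-suc-≤ (down ∷ p) zero    = ≤-refl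
downs-suc-≤ (s ∷ p)    (suc t) =
  ≤-trans (+-monoʳ-≤ (isDown s) (downs-suc-≤ p t)) (≤-reflexive (+-suc (isDown s) _))

downs-mono : ∀ p {t t′} → t ≤ t′ → downs p t ≤ downs p t′
downs-mono p {t} {t′} t≤t′ with m≤n⇒m<n∨m≡n t≤t′
downs-mono p {t} {suc t′} _ | inj₁ (s≤s t≤t′) = ≤-trans (downs-mono p t≤t′) (downs-suc-≥ p t′)
... | inj₂ refl = ≤-refl

downs-applyUpTo-suc : ∀ (f : ℕ → Step) {N x} → x < N →
  downs (applyUpTo f N) (suc x) ≡ isDown (f x) + downs (applyUpTo f N) x
downs-applyUpTo-suc f {suc N} {zero}  _         = refl
downs-applyUpTo-suc f {suc N} {suc x} (s≤s x<N) =
  trans (cong (isDown (f 0) +_) (downs-applyUpTo-suc (λ y → f (suc y)) x<N))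
        (x∙yz≈y∙xz (isDown (f 0)) (isDown (f (suc x))) _)

downs-injective : ∀ p q → length p ≡ length q → (∀ x → x ≤ length p → downs p x ≡ downs q x) → p ≡ q
downs-injective []      []       _    _      = refl
downs-injective (s ∷ p) (s′ ∷ q) len≡ downs≡ =
  cong₂ _∷_ s≡s′ (downs-injective p q (suc-injective len≡) λ x x≤ →
    +-cancelˡ-≡ (isDown s) _ _
      (trans (downs≡ (suc x) (s≤s x≤)) (cong (λ s → isDown s + downs q x) (sym s≡s′))))
  where
  s≡s′ : s ≡ s′
  s≡s′ = isDown-injective (+-cancelʳ-≡ 0 _ _ (downs≡ 1 (s≤s z≤n)))

onPath⇒downs : ∀ p j b → OnPath p (2 * j + b) b → downs p (2 * j + b) ≡ j
onPath⇒downs p j b (x≤p , h) = sym (*-cancelˡ-≡ j d 2 (+-cancelʳ-≡ b (2 * j) (2 * d) x≡))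
  where
  d : ℕ
  d = downs p (2 * j + b)
  x≡ : 2 * j + b ≡ 2 * d + b
  x≡ = trans (⊖≡+⇒ (trans (sym (heightAt≡⊖downs p _ x≤p)) h)) (+-comm b (2 * d))

downs⇒onPath : ∀ p j b → 2 * j + b ≤ length p → downs p (2 * j + b) ≡ j → OnPath p (2 * j + b) b
downs⇒onPath p j b x≤p d≡j = x≤p , (begin
  heightAt p (2 * j + b)                 ≡⟨ heightAt≡⊖downs p _ x≤p ⟩
  (2 * j + b) ⊖ 2 * downs p (2 * j + b)  ≡⟨ cong (λ d → (2 * j + b) ⊖ 2 * d) d≡j ⟩
  (2 * j + b) ⊖ 2 * j                    ≡⟨ cong ((2 * j + b) ⊖_) (+-identityʳ (2 * j)) ⟨
  (2 * j + b) ⊖ (2 * j + 0)              ≡⟨ ℤ.+-cancelˡ-⊖ (2 * j) b 0 ⟩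
  ℤ.+ b                                  ∎)
  where open ≡-Reasoning

record Largest (P : ℕ → Set) (N : ℕ) : Set where
  field
    value   : ℕ
    bounded : value ≤ N
    holds   : P value
    maximal : ∀ y → y ≤ N → P y → y ≤ value

largest : {P : ℕ → Set} → Decidable P → P 0 → ∀ N → Largest P N
largest P? P0 zero = record { value = 0 ; bounded = z≤n ; holds = P0 ; maximal = λ { _ z≤n _ → z≤n } }
largest {P} P? P0 (suc N) with P? (suc N)
... | yes PN = record { value = suc N ; bounded = ≤-refl ; holds = PN ; maximal = λ _ y≤N _ → y≤N }
... | no ¬PN = record { value = value ; bounded = m≤n⇒m≤1+n bounded ; holds = holds ; maximal = maximal′ }
  where
  open Largest (largest P? P0 N)
  maximal′ : ∀ y → y ≤ suc N → P y → y ≤ value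
  maximal′ y y≤ Py with m≤n⇒m<n∨m≡n y≤
  ... | inj₁ (s≤s y≤N) = maximal y y≤N Py
  ... | inj₂ refl      = ⊥-elim (¬PN Py)

-- Dyck paths and area sequences

-- b j stands for a_j − 1, where a = [a_0, …, a_k] is an area sequence.
record AreaProfile (k : ℕ) (b : ℕ → ℕ) : Set where
  field
    positive : ∀ j → j < k → 1 ≤ b j
    final    : b k ≡ 0
    descent  : ∀ j → j < k → b j ≤ suc (b (suc j))

HasProfile : ∀ {k} → DyckPath k → (ℕ → ℕ) → Set
HasProfile {k} D b = ∀ j → j ≤ k → AreaEntry D j (suc (b j))

areaEntry-unique : ∀ {k} (D : DyckPath k) j {a a′} → AreaEntry D j a → AreaEntry D j a′ → a ≡ a′
areaEntry-unique D j {suc b} {suc b′} (onPath , maximal) (onPath′ , maximal′) =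
  cong suc (≤-antisym (maximal′ b onPath) (maximal b′ onPath′))

hasProfile-cong : ∀ {k b b′} (D : DyckPath k) → (∀ j → j ≤ k → b j ≡ b′ j) → HasProfile D b → HasProfile D b′
hasProfile-cong D b≡b′ hp j j≤k = subst (λ x → AreaEntry D j (suc x)) (b≡b′ j j≤k) (hp j j≤k)

module DyckPathProfile {k : ℕ} (D : DyckPath k) where
  private
    p : List Step
    p = steps D

  inRange : ∀ {t} → t ≤ 2 * k → t ≤ length p
  inRange {t} = subst (t ≤_) (sym (len D))

  2*downs≤ : ∀ t → t ≤ 2 * k → 2 * downs p t ≤ t
  2*downs≤ t t≤2k = 0≤⊖⇒≤ (subst (0ℤ ≤ℤ_) (heightAt≡⊖downs p t (inRange t≤2k)) (nonneg D t t≤2k))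

  downs≤k : ∀ x → x ≤ 2 * k → downs p x ≤ k
  downs≤k x x≤2k = *-cancelˡ-≤ 2 (≤-trans (2*downs≤ x x≤2k) x≤2k)

  downs-total : downs p (2 * k) ≡ k
  downs-total = *-cancelˡ-≡ _ k 2
    (sym (⊖≡+⇒ (trans (sym (heightAt≡⊖downs p (2 * k) (inRange ≤-refl))) (endsAtZero D))))

  lastWithin : (j : ℕ) → Largest (λ x → downs p x ≤ j) (2 * k)
  lastWithin j = largest (λ x → downs p x ≤? j) z≤n (2 * k)

  -- the last point of the path before its (j+1)-th down-step; for j ≤ k it is
  -- (2j + profile j, profile j)
  lastPoint : ℕ → ℕ
  lastPoint j = Largest.value (lastWithin j)

  profile : ℕ → ℕ
  profile j = lastPoint j ∸ 2 * j

  lastPoint-≤ : ∀ j → lastPoint j ≤ 2 * k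
  lastPoint-≤ j = Largest.bounded (lastWithin j)

  lastPoint-maximal : ∀ j y → y ≤ 2 * k → downs p y ≤ j → y ≤ lastPoint j
  lastPoint-maximal j = Largest.maximal (lastWithin j)

  lastPoint-next : ∀ j → lastPoint j < 2 * k → suc j ≤ downs p (suc (lastPoint j))
  lastPoint-next j x<2k with downs p (suc (lastPoint j)) ≤? j
  ... | yes d≤j = ⊥-elim (1+n≰n (lastPoint-maximal j _ x<2k d≤j))
  ... | no  d≰j = ≰⇒> d≰j

  downs-lastPoint : ∀ j → j ≤ k → downs p (lastPoint j) ≡ j
  downs-lastPoint j j≤k = ≤-antisym (Largest.holds (lastWithin j)) j≤downs
    where
    j≤downs : j ≤ downs p (lastPoint j)
    j≤downs with m≤n⇒m<n∨m≡n (lastPoint-≤ j)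
    ... | inj₁ x<2k = ≤-pred (≤-trans (lastPoint-next j x<2k) (downs-suc-≤ p (lastPoint j)))
    ... | inj₂ x≡2k = subst (j ≤_) (sym (trans (cong (downs p) x≡2k) downs-total)) j≤k

  lastPoint-< : ∀ j → j < k → lastPoint j < 2 * k
  lastPoint-< j j<k with m≤n⇒m<n∨m≡n (lastPoint-≤ j)
  ... | inj₁ x<2k = x<2k
  ... | inj₂ x≡2k = ⊥-elim (<⇒≢ j<k (trans (sym (downs-lastPoint j (<⇒≤ j<k)))
                                           (trans (cong (downs p) x≡2k) downs-total)))

  downs-after-lastPoint : ∀ j → j < k → downs p (suc (lastPoint j)) ≡ suc j
  downs-after-lastPoint j j<k = ≤-antisym
    (subst (λ d → downs p (suc (lastPoint j)) ≤ suc d) (downs-lastPoint j (<⇒≤ j<k)) (downs-suc-≤ p _))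
    (lastPoint-next j (lastPoint-< j j<k))

  lastPoint≡ : ∀ j → j ≤ k → lastPoint j ≡ 2 * j + profile j
  lastPoint≡ j j≤k = sym (m+[n∸m]≡n
    (subst (λ d → 2 * d ≤ lastPoint j) (downs-lastPoint j j≤k) (2*downs≤ _ (lastPoint-≤ j))))

  hasProfile : HasProfile D profile
  hasProfile j j≤k = onPath , maximal
    where
    x≡ : lastPoint j ≡ 2 * j + profile j
    x≡ = lastPoint≡ j j≤k
    onPath : OnPath p (2 * j + profile j) (profile j)
    onPath = downs⇒onPath p j (profile j) (inRange (subst (_≤ 2 * k) x≡ (lastPoint-≤ j)))
      (subst (λ x → downs p x ≡ j) x≡ (downs-lastPoint j j≤k))
    maximal : ∀ b → OnPath p (2 * j + b) b → b ≤ profile j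
    maximal b onPath′ = +-cancelˡ-≤ (2 * j) b (profile j) (subst (2 * j + b ≤_) x≡
      (lastPoint-maximal j _ (subst (2 * j + b ≤_) (len D) (proj₁ onPath′))
        (≤-reflexive (onPath⇒downs p j b onPath′))))

  areaProfile : AreaProfile k profile
  areaProfile = record { positive = positive ; final = final ; descent = descent }
    where
    positive : ∀ j → j < k → 1 ≤ profile j
    positive j j<k = m<n⇒0<n∸m (≤-pred (subst (_≤ suc (lastPoint j))
      (trans (cong (2 *_) (downs-after-lastPoint j j<k)) (*-suc 2 j)) (2*downs≤ _ (lastPoint-< j j<k))))
    final : profile k ≡ 0
    final = trans (cong (_∸ 2 * k) (≤-antisym (lastPoint-≤ k)
                    (lastPoint-maximal k (2 * k) ≤-refl (≤-reflexive downs-total)))) (n∸n≡0 (2 * k))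
    next≤ : ∀ j → j < k → suc (lastPoint j) ≤ lastPoint (suc j)
    next≤ j j<k = lastPoint-maximal (suc j) _ (lastPoint-< j j<k) (≤-reflexive (downs-after-lastPoint j j<k))
    descent : ∀ j → j < k → profile j ≤ suc (profile (suc j))
    descent j j<k = +-cancelˡ-≤ (2 * j) _ _ (subst (2 * j + profile j ≤_) (sym (+-suc (2 * j) _))
      (≤-pred (subst₂ (λ x y → suc x ≤ y) (lastPoint≡ j (<⇒≤ j<k))
        (trans (lastPoint≡ (suc j) j<k) (cong (_+ profile (suc j)) (*-suc 2 j))) (next≤ j j<k))))

  down-at-lastPoint : ∀ {x j b} → x < 2 * k → downs p x ≡ j → AreaEntry D j (suc b) →
                      x ≡ 2 * j + b → downs p (suc x) ≡ suc j
  down-at-lastPoint {x} {j} {b} x<2k d≡j (_ , maximal) x≡ = ≤-antisym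
    (subst (λ d → downs p (suc x) ≤ suc d) d≡j (downs-suc-≤ p x))
    (≤∧≢⇒< (subst (_≤ downs p (suc x)) d≡j (downs-suc-≥ p x)) j≢)
    where
    sx≡ : 2 * j + suc b ≡ suc x
    sx≡ = trans (+-suc (2 * j) b) (cong suc (sym x≡))
    j≢ : j ≢ downs p (suc x)
    j≢ j≡ = 1+n≰n (maximal (suc b) (downs⇒onPath p j (suc b)
      (inRange (subst (_≤ 2 * k) (sym sx≡) x<2k)) (trans (cong (downs p) sx≡) (sym j≡))))

  up-off-lastPoint : ∀ {x j b} → x < 2 * k → downs p x ≡ j → AreaEntry D j (suc b) →
                     x ≢ 2 * j + b → downs p (suc x) ≡ j
  up-off-lastPoint {x} {j} {b} x<2k d≡j (onPath , maximal) x≢ = ≤-antisym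
    (subst (downs p (suc x) ≤_) (onPath⇒downs p j b onPath) (downs-mono p sx≤))
    (subst (_≤ downs p (suc x)) d≡j (downs-suc-≥ p x))
    where
    x≡ : 2 * j + (x ∸ 2 * j) ≡ x
    x≡ = m+[n∸m]≡n (subst (λ d → 2 * d ≤ x) d≡j (2*downs≤ x (<⇒≤ x<2k)))
    x∸2j≤b : x ∸ 2 * j ≤ b
    x∸2j≤b = maximal (x ∸ 2 * j) (downs⇒onPath p j _ (inRange (subst (_≤ 2 * k) (sym x≡) (<⇒≤ x<2k)))
                                    (trans (cong (downs p) x≡) d≡j))
    sx≤ : suc x ≤ 2 * j + b
    sx≤ = ≤∧≢⇒< (subst (_≤ 2 * j + b) x≡ (+-monoʳ-≤ (2 * j) x∸2j≤b)) x≢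

-- level x counts the down-steps among the first x steps of the path that steps
-- down exactly at the points lastPoint j.
module PathFromProfile (b : ℕ → ℕ) where
  lastPoint : ℕ → ℕ
  lastPoint j = 2 * j + b j

  level  : ℕ → ℕ
  stepAt : ℕ → Step

  level zero    = 0
  level (suc x) = isDown (stepAt x) + level x

  stepAt x with x ≟ lastPoint (level x)
  ... | yes _ = down
  ... | no  _ = up

  module _ {k : ℕ} (prof : AreaProfile k b) where
    open AreaProfile prof

    lastPoint-suc : ∀ j → j < k → lastPoint j < lastPoint (suc j)
    lastPoint-suc j j<k = subst (lastPoint j <_) (cong (_+ b (suc j)) (sym (*-suc 2 j)))
      (s≤s (≤-trans (+-monoʳ-≤ (2 * j) (descent j j<k)) (≤-reflexive (+-suc (2 * j) _))))

    lastPoint-<-mono : ∀ {i j} → i < j → j ≤ k → lastPoint i < lastPoint j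
    lastPoint-<-mono {i} {suc j} (s≤s i≤j) j<k with m≤n⇒m<n∨m≡n i≤j
    ... | inj₁ i<j  = <-trans (lastPoint-<-mono i<j (<⇒≤ j<k)) (lastPoint-suc j j<k)
    ... | inj₂ refl = lastPoint-suc j j<k

    lastPoint-≤-mono : ∀ {i j} → i ≤ j → j ≤ k → lastPoint i ≤ lastPoint j
    lastPoint-≤-mono i≤j j≤k with m≤n⇒m<n∨m≡n i≤j
    ... | inj₁ i<j  = <⇒≤ (lastPoint-<-mono i<j j≤k)
    ... | inj₂ refl = ≤-refl

    lastPoint-cancel-≤ : ∀ {i j} → i ≤ k → lastPoint i ≤ lastPoint j → i ≤ j
    lastPoint-cancel-≤ i≤k x≤y = ≮⇒≥ λ j<i → <⇒≱ (lastPoint-<-mono j<i i≤k) x≤y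

    lastPoint-cancel-< : ∀ {i j} → i ≤ k → lastPoint i < lastPoint j → i < j
    lastPoint-cancel-< i≤k x<y = ≰⇒> λ j≤i → <⇒≱ x<y (lastPoint-≤-mono j≤i i≤k)

    lastPoint-final : lastPoint k ≡ 2 * k
    lastPoint-final = trans (cong (2 * k +_) final) (+-identityʳ (2 * k))

    lastPoint-≤ : ∀ j → j ≤ k → lastPoint j ≤ 2 * k
    lastPoint-≤ j j≤k = subst (lastPoint j ≤_) lastPoint-final (lastPoint-≤-mono j≤k ≤-refl)

    Separates : ℕ → Set
    Separates x = ∀ j → j ≤ k → (level x ≤ j) ⇔ (x ≤ lastPoint j)

    Separates⇒level≤k : ∀ {x} → x ≤ 2 * k → Separates x → level x ≤ k
    Separates⇒level≤k {x} x≤2k sep = Equivalence.from (sep k ≤-refl) (subst (x ≤_) (sym lastPoint-final) x≤2k)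

    separates : ∀ x → x ≤ 2 * k → Separates x
    separates zero    _    j j≤k = mk⇔ (λ _ → z≤n) (λ _ → z≤n)
    separates (suc x) x<2k j j≤k with x ≟ lastPoint (level x)
    ... | yes x≡ = mk⇔ (λ ℓ<j → subst (_< lastPoint j) (sym x≡) (lastPoint-<-mono ℓ<j j≤k))
                       (λ x<y → lastPoint-cancel-< ℓ≤k (subst (_< lastPoint j) x≡ x<y))
      where
      ℓ≤k : level x ≤ k
      ℓ≤k = Separates⇒level≤k (<⇒≤ x<2k) (separates x (<⇒≤ x<2k))
    ... | no x≢ = mk⇔ (λ ℓ≤j → ≤∧≢⇒< (Equivalence.to (sep j j≤k) ℓ≤j) (x≢y ℓ≤j))
                      (λ x<y → Equivalence.from (sep j j≤k) (<⇒≤ x<y))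
      where
      sep : Separates x
      sep = separates x (<⇒≤ x<2k)
      x≤ℓ : x ≤ lastPoint (level x)
      x≤ℓ = Equivalence.to (sep (level x) (Separates⇒level≤k (<⇒≤ x<2k) sep)) ≤-refl
      x≢y : level x ≤ j → x ≢ lastPoint j
      x≢y ℓ≤j x≡y = x≢ (trans x≡y (cong lastPoint (≤-antisym j≤ℓ ℓ≤j)))
        where
        j≤ℓ : j ≤ level x
        j≤ℓ = lastPoint-cancel-≤ j≤k (subst (_≤ lastPoint (level x)) x≡y x≤ℓ)

    level-lastPoint : ∀ j → j ≤ k → level (lastPoint j) ≡ j
    level-lastPoint j j≤k = ≤-antisym (Equivalence.from (sep j j≤k) ≤-refl) (≮⇒≥ λ ℓ<j →
        <⇒≱ (lastPoint-<-mono ℓ<j j≤k) (Equivalence.to (sep _ (≤-trans (<⇒≤ ℓ<j) j≤k)) ≤-refl))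
      where
      sep : Separates (lastPoint j)
      sep = separates (lastPoint j) (lastPoint-≤ j j≤k)

    2*level≤ : ∀ x → x ≤ 2 * k → 2 * level x ≤ x
    2*level≤ x x≤2k with level x in ℓ≡
    ... | zero  = z≤n
    ... | suc i = subst (_≤ x) (sym (*-suc 2 i)) (≤-trans (s≤s 2i<y) y<x)
      where
      sep : Separates x
      sep = separates x x≤2k
      i<k : i < k
      i<k = subst (_≤ k) ℓ≡ (Separates⇒level≤k x≤2k sep)
      2i<y : 2 * i < lastPoint i
      2i<y = subst (_≤ lastPoint i) (+-comm (2 * i) 1) (+-monoʳ-≤ (2 * i) (positive i i<k))
      y<x : lastPoint i < x
      y<x = ≰⇒> λ x≤y → 1+n≰n (subst (_≤ i) ℓ≡ (Equivalence.from (sep i (<⇒≤ i<k)) x≤y))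

    path : List Step
    path = applyUpTo stepAt (2 * k)

    downs-path : ∀ x → x ≤ 2 * k → downs path x ≡ level x
    downs-path zero    _    = refl
    downs-path (suc x) x<2k = trans (downs-applyUpTo-suc stepAt x<2k)
                                    (cong (isDown (stepAt x) +_) (downs-path x (<⇒≤ x<2k)))

    length-path : length path ≡ 2 * k
    length-path = length-applyUpTo stepAt (2 * k)

    inRange : ∀ {t} → t ≤ 2 * k → t ≤ length path
    inRange {t} = subst (t ≤_) (sym length-path)

    heightAt-path : ∀ t → t ≤ 2 * k → heightAt path t ≡ t ⊖ 2 * level t
    heightAt-path t t≤2k =
      trans (heightAt≡⊖downs path t (inRange t≤2k)) (cong (λ d → t ⊖ 2 * d) (downs-path t t≤2k))

    dyckPath : DyckPath k
    dyckPath = record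
      { steps      = path
      ; len        = length-path
      ; nonneg     = λ t t≤2k → subst (0ℤ ≤ℤ_) (sym (trans (heightAt-path t t≤2k) (ℤ.⊖-≥ (2*level≤ t t≤2k))))
                                      (+≤+ z≤n)
      ; endsAtZero = trans (heightAt-path (2 * k) ≤-refl)
                           (trans (cong (λ d → 2 * k ⊖ 2 * d) level-total) (ℤ.n⊖n≡0 (2 * k)))
      }
      where
      level-total : level (2 * k) ≡ k
      level-total = subst (λ x → level x ≡ k) lastPoint-final (level-lastPoint k ≤-refl)

    hasProfile : HasProfile dyckPath b
    hasProfile j j≤k = downs⇒onPath path j (b j) (inRange (lastPoint-≤ j j≤k))
                         (trans (downs-path _ (lastPoint-≤ j j≤k)) (level-lastPoint j j≤k))
                     , maximal
      where
      maximal : ∀ b′ → OnPath path (2 * j + b′) b′ → b′ ≤ b j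
      maximal b′ onPath = +-cancelˡ-≤ (2 * j) b′ (b j) (Equivalence.to (separates _ x≤2k j j≤k)
        (≤-reflexive (trans (sym (downs-path _ x≤2k)) (onPath⇒downs path j b′ onPath))))
        where
        x≤2k : 2 * j + b′ ≤ 2 * k
        x≤2k = subst (2 * j + b′ ≤_) length-path (proj₁ onPath)

downs≡level : ∀ {k b} (D : DyckPath k) → HasProfile D b →
              ∀ x → x ≤ 2 * k → downs (steps D) x ≡ PathFromProfile.level b x
downs≡level D hp zero    _    = refl
downs≡level {k} {b} D hp (suc x) x<2k = next (downs≡level D hp x (<⇒≤ x<2k))
  where
  open DyckPathProfile D using (downs≤k; down-at-lastPoint; up-off-lastPoint)
  open PathFromProfile b using (level; lastPoint)
  area : downs (steps D) x ≡ level x → AreaEntry D (level x) (suc (b (level x)))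
  area IH = hp (level x) (subst (_≤ k) IH (downs≤k x (<⇒≤ x<2k)))
  next : downs (steps D) x ≡ level x → downs (steps D) (suc x) ≡ level (suc x)
  next IH with x ≟ lastPoint (level x)
  ... | yes x≡ = down-at-lastPoint x<2k IH (area IH) x≡
  ... | no  x≢ = up-off-lastPoint  x<2k IH (area IH) x≢

hasProfile-unique : ∀ {k b} (D D′ : DyckPath k) → HasProfile D b → HasProfile D′ b → steps D ≡ steps D′
hasProfile-unique {k} {b} D D′ hp hp′ = downs-injective _ _ (trans (len D) (sym (len D′))) λ x x≤ →
  trans (downs≡level D hp x (x≤2k x≤)) (sym (downs≡level D′ hp′ x (x≤2k x≤)))
  where
  x≤2k : ∀ {x} → x ≤ length (steps D) → x ≤ 2 * k
  x≤2k {x} = subst (x ≤_) (len D)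

-- Kupisch series

%-cong-+ˡ : ∀ a {x y} n .{{_ : NonZero n}} → x % n ≡ y % n → (a + x) % n ≡ (a + y) % n
%-cong-+ˡ a {x} {y} n x≡y = begin
  (a + x) % n          ≡⟨ %-distribˡ-+ a x n ⟩
  (a % n + x % n) % n  ≡⟨ cong (λ z → (a % n + z) % n) x≡y ⟩
  (a % n + y % n) % n  ≡⟨ %-distribˡ-+ a y n ⟨
  (a + y) % n          ∎
  where open ≡-Reasoning

%-cong-+ʳ : ∀ {x y} a n .{{_ : NonZero n}} → x % n ≡ y % n → (x + a) % n ≡ (y + a) % n
%-cong-+ʳ {x} {y} a n x≡y = subst₂ (λ u v → u % n ≡ v % n) (+-comm a x) (+-comm a y) (%-cong-+ˡ a n x≡y)

%-cancel-+ˡ : ∀ a {x y} n .{{_ : NonZero n}} → (a + x) % n ≡ (a + y) % n → x % n ≡ y % n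
%-cancel-+ˡ a {x} {y} n eq = trans (sym (shift x)) (trans (%-cong-+ˡ (a * n ∸ a) n eq) (shift y))
  where
  open ≡-Reasoning
  shift : ∀ z → (a * n ∸ a + (a + z)) % n ≡ z % n
  shift z = trans (cong (_% n) (begin
    a * n ∸ a + (a + z)  ≡⟨ +-assoc (a * n ∸ a) a z ⟨
    a * n ∸ a + a + z    ≡⟨ cong (_+ z) (m∸n+n≡m (m≤m*n a n)) ⟩
    a * n + z            ≡⟨ +-comm (a * n) z ⟩
    z + a * n            ∎)) ([m+kn]%n≡m%n z a n)

module _ {m : ℕ} where
  private
    n : ℕ
    n = suc m

  toℕ-mod : ∀ x → toℕ (x mod n) ≡ x % n
  toℕ-mod x = toℕ-fromℕ< (m%n<n x n)

  kupAt-cong : (v : Vec ℕ n) (x y : ℕ) → x % n ≡ y % n → kupAt v x ≡ kupAt v y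
  kupAt-cong v x y x≡y = cong (lookup v) (fromℕ<-cong _ _ x≡y (m%n<n x n) (m%n<n y n))

  lookup≡kupAt : (v : Vec ℕ n) (i : Fin n) → lookup v i ≡ kupAt v (toℕ i)
  lookup≡kupAt v i = cong (lookup v) (toℕ-injective (sym (trans (toℕ-mod (toℕ i)) (m<n⇒m%n≡m (toℕ<n i)))))

  kupAt-periodic : (v : Vec ℕ n) (x : ℕ) → kupAt v (x + n) ≡ kupAt v x
  kupAt-periodic v x = kupAt-cong v (x + n) x ([m+n]%n≡m%n x n)

  sincere⇒n≤ : (A : Nakayama m) → Sincere A → ∀ x → n ≤ c[ A ] x
  sincere⇒n≤ A sincere x with sincere (x mod n) ((toℕ (x mod n) + m) mod n)
  ... | k , k<c , i+k≡i+m = ≤-trans (s≤s m≤k) k<c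
    where
    i : ℕ
    i = toℕ (x mod n)
    k≡m : k % n ≡ m
    k≡m = trans (%-cancel-+ˡ i n (trans (sym (toℕ-mod (i + k))) (trans (cong toℕ i+k≡i+m) (toℕ-mod (i + m)))))
                (m<n⇒m%n≡m ≤-refl)
    m≤k : m ≤ k
    m≤k = subst (_≤ k) k≡m (m%n≤m k n)

  n≤⇒sincere : (A : Nakayama m) → (∀ i → n ≤ lookup (kupisch A) i) → Sincere A
  n≤⇒sincere A n≤c i j = k , ≤-trans (m%n<n (n ∸ toℕ i + toℕ j) n) (n≤c i)
                           , toℕ-injective (trans (toℕ-mod (toℕ i + k)) i+k≡j)
    where
    open ≡-Reasoning
    k : ℕ
    k = (n ∸ toℕ i + toℕ j) % n
    i+k≡j : (toℕ i + k) % n ≡ toℕ j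
    i+k≡j = begin
      (toℕ i + k) % n                    ≡⟨ %-cong-+ˡ (toℕ i) n (m%n%n≡m%n (n ∸ toℕ i + toℕ j) n) ⟩
      (toℕ i + (n ∸ toℕ i + toℕ j)) % n  ≡⟨ cong (_% n) (+-assoc (toℕ i) _ (toℕ j)) ⟨
      (toℕ i + (n ∸ toℕ i) + toℕ j) % n  ≡⟨ cong (λ z → (z + toℕ j) % n) (m+[n∸m]≡n (<⇒≤ (toℕ<n i))) ⟩
      (n + toℕ j) % n                    ≡⟨ cong (_% n) (+-comm n (toℕ j)) ⟩
      (toℕ j + n) % n                    ≡⟨ [m+n]%n≡m%n (toℕ j) n ⟩
      toℕ j % n                          ≡⟨ m<n⇒m%n≡m (toℕ<n j) ⟩
      toℕ j                              ∎

  sincere⇒kupisch-step : (A : Nakayama m) → Sincere A → ∀ x → c[ A ] x ≤ suc (c[ A ] (suc x))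
  sincere⇒kupisch-step A sincere x = step (kind A) (valid A)
    where
    v : Vec ℕ n
    v = kupisch A
    step : (q : QuiverType) → ValidKupisch q v → kupAt v x ≤ suc (kupAt v (suc x))
    step cyclic valid-v = subst (λ c → kupAt v x ≤ suc c) (kupAt-cong v (suc (toℕ (x mod n))) (suc x) sx≡)
                                (proj₂ (valid-v (x mod n)))
      where
      sx≡ : suc (toℕ (x mod n)) % n ≡ suc x % n
      sx≡ = trans (cong (λ z → suc z % n) (toℕ-mod x)) (%-cong-+ˡ 1 n (m%n%n≡m%n x n))
    -- a sincere linear Nakayama algebra has n = 1, so all indices agree modulo n
    step linear (_ , last≡1) = ≤-trans (≤-reflexive (kupAt-cong v x (suc x) (trans (%n≡0 x) (sym (%n≡0 (suc x))))))
                                       (n≤1+n _)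
      where
      n≤1 : n ≤ 1
      n≤1 = subst (n ≤_) last≡1 (sincere⇒n≤ A sincere m)
      %n≡0 : ∀ y → y % n ≡ 0
      %n≡0 y = n<1⇒n≡0 (≤-trans (m%n<n y n) n≤1)

  module _ (A : Nakayama m) where
    private
      c : ℕ → ℕ
      c = c[ A ]

    PdLe-suc : ∀ d i l → PdLe A d i l → PdLe A (suc d) i l
    PdLe-suc zero    i l proj        = inj₁ proj
    PdLe-suc (suc d) i l (inj₁ proj) = inj₁ proj
    PdLe-suc (suc d) i l (inj₂ pd)   = inj₂ (PdLe-suc d _ _ pd)

    PdLe-cong : ∀ d i j l → i % n ≡ j % n → PdLe A d i l → PdLe A d j l
    PdLe-cong zero    i j l i≡j proj        = trans proj (kupAt-cong (kupisch A) i j i≡j)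
    PdLe-cong (suc d) i j l i≡j (inj₁ proj) = inj₁ (trans proj (kupAt-cong (kupisch A) i j i≡j))
    PdLe-cong (suc d) i j l i≡j (inj₂ pd)   =
      inj₂ (subst (λ cj → PdLe A d (j + l) (cj ∸ l)) (kupAt-cong (kupisch A) i j i≡j)
                  (PdLe-cong d (i + l) (j + l) _ (%-cong-+ʳ {i} {j} l n i≡j) pd))

    SyzygyClosed : (ℕ → ℕ → Set) → Set
    SyzygyClosed F = ∀ i l → F i l → (l ≢ c i) × F (i + l) (c i ∸ l)

    syzygyClosed⇒¬PdLe : ∀ {F} → SyzygyClosed F → ∀ d i l → F i l → ¬ PdLe A d i l
    syzygyClosed⇒¬PdLe closed zero    i l Fil proj        = proj₁ (closed i l Fil) proj
    syzygyClosed⇒¬PdLe closed (suc d) i l Fil (inj₁ proj) = proj₁ (closed i l Fil) proj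
    syzygyClosed⇒¬PdLe closed (suc d) i l Fil (inj₂ pd)   =
      syzygyClosed⇒¬PdLe closed d _ _ (proj₂ (closed i l Fil)) pd

    -- the syzygy of M(i, n) has length c_i − n, and that of M(i, c_i − n) has length n
    noProjOfDim⇒infinite : Sincere A → (∀ x → c x ≢ n) → ¬ FiniteGlDim A
    noProjOfDim⇒infinite sincere c≢n (d , allPd) =
      syzygyClosed⇒¬PdLe closed d 0 n (inj₁ refl) (allPd fzero n (s≤s z≤n) (sincere⇒n≤ A sincere 0))
      where
      F : ℕ → ℕ → Set
      F i l = (l ≡ n) ⊎ (l + n ≡ c i)
      closed : SyzygyClosed F
      closed i l (inj₁ refl)  = (λ n≡c → c≢n i (sym n≡c))
                              , inj₂ (trans (m∸n+n≡m (sincere⇒n≤ A sincere i))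
                                            (sym (kupAt-periodic (kupisch A) i)))
      closed i l (inj₂ l+n≡c) = (λ l≡c → <⇒≢ (m<m+n l z<s) (trans l≡c (sym l+n≡c)))
                              , inj₁ (trans (cong (_∸ l) (sym l+n≡c)) (m+n∸m≡n l n))

    -- if c_i = c_{i+l} = n with 0 < l < n, the syzygy M(i + l, n − l) of M(i, l)
    -- is of the same kind
    twoProjsOfDim⇒infinite : (p : Fin n) (l : ℕ) → 0 < l → l < n →
                             c (toℕ p) ≡ n → c (toℕ p + l) ≡ n → ¬ FiniteGlDim A
    twoProjsOfDim⇒infinite p l 0<l l<n cp≡n cpl≡n (d , allPd) =
      syzygyClosed⇒¬PdLe closed d (toℕ p) l (cp≡n , 0<l , l<n , cpl≡n)
        (allPd p l 0<l (≤-trans (<⇒≤ l<n) (≤-reflexive (sym cp≡n))))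
      where
      F : ℕ → ℕ → Set
      F i l = (c i ≡ n) × (0 < l) × (l < n) × (c (i + l) ≡ n)
      closed : SyzygyClosed F
      closed i l (ci≡n , 0<l , l<n , cil≡n) rewrite ci≡n =
          (λ l≡n → <⇒≢ l<n l≡n)
        , cil≡n , m<n⇒0<n∸m l<n , ∸-monoʳ-< 0<l (<⇒≤ l<n)
        , (begin
            c (i + l + (n ∸ l))  ≡⟨ cong c (trans (+-assoc i l _) (cong (i +_) (m+[n∸m]≡n (<⇒≤ l<n)))) ⟩
            c (i + n)            ≡⟨ kupAt-periodic (kupisch A) i ⟩
            c i                  ≡⟨ ci≡n ⟩
            n                    ∎)
        where open ≡-Reasoning

    finite⇒unique : Sincere A → FiniteGlDim A → UniqueProjOfDim A n
    finite⇒unique sincere finite with any? (λ i → lookup (kupisch A) i ≟ n)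
    ... | no ∄i          = ⊥-elim (noProjOfDim⇒infinite sincere (λ x cx≡n → ∄i (x mod n , cx≡n)) finite)
    ... | yes (i , ci≡n) = i , ci≡n , λ j cj≡n → atMostOne j i cj≡n ci≡n
      where
      apart : ∀ p q → toℕ p < toℕ q → lookup (kupisch A) p ≡ n → lookup (kupisch A) q ≡ n → ⊥
      apart p q p<q cp≡n cq≡n = twoProjsOfDim⇒infinite p (toℕ q ∸ toℕ p) (m<n⇒0<n∸m p<q)
        (≤-<-trans (m∸n≤m (toℕ q) (toℕ p)) (toℕ<n q))
        (trans (sym (lookup≡kupAt (kupisch A) p)) cp≡n)
        (trans (cong c (m+[n∸m]≡n (<⇒≤ p<q))) (trans (sym (lookup≡kupAt (kupisch A) q)) cq≡n))
        finite
      atMostOne : ∀ p q → lookup (kupisch A) p ≡ n → lookup (kupisch A) q ≡ n → p ≡ q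
      atMostOne p q cp≡n cq≡n with <-cmp (toℕ p) (toℕ q)
      ... | tri< p<q _ _ = ⊥-elim (apart p q p<q cp≡n cq≡n)
      ... | tri≈ _ p≡q _ = toℕ-injective p≡q
      ... | tri> _ _ q<p = ⊥-elim (apart q p q<p cq≡n cp≡n)

sincere-cyclic : ∀ {m} (A : Nakayama (suc m)) → Sincere A → kind A ≡ cyclic
sincere-cyclic {m} A sincere = kind≡cyclic (kind A) (valid A)
  where
  kind≡cyclic : (q : QuiverType) → ValidKupisch q (kupisch A) → q ≡ cyclic
  kind≡cyclic cyclic _            = refl
  kind≡cyclic linear (_ , last≡1) = ⊥-elim (1+n≰n (≤-trans (s≤s (s≤s z≤n))
    (subst (suc (suc m) ≤_) last≡1 (sincere⇒n≤ A sincere (suc m)))))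

finite-linear : (A : Nakayama 0) → Sincere A → FiniteGlDim A → kind A ≡ linear
finite-linear A sincere finite = kind≡linear (kind A) (valid A)
  where
  unique : UniqueProjOfDim A 1
  unique = finite⇒unique A sincere finite
  kind≡linear : (q : QuiverType) → ValidKupisch q (kupisch A) → q ≡ linear
  kind≡linear linear _       = refl
  kind≡linear cyclic valid-v =
    ⊥-elim (1+n≰n (subst (2 ≤_) (proj₁ (proj₂ unique)) (proj₁ (valid-v (proj₁ unique)))))

-- Syzygies of segments

iterate-suc : ∀ {A : Set} (f : A → A) x j → iterate f x (suc j) ≡ f (iterate f x j)
iterate-suc f x j = trans (sym (iterate-is-fold x f (suc j))) (cong f (iterate-is-fold x f j))

module MinimalProjective {m : ℕ} (A : Nakayama m) (sincere : Sincere A) (unique : UniqueProjOfDim A (suc m)) where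
  private
    n : ℕ
    n = suc m
    c : ℕ → ℕ
    c = c[ A ]

  ρ : ℕ
  ρ = toℕ (proj₁ unique)

  C : ℕ → ℕ
  C y = c (ρ + y)

  C0≡n : C 0 ≡ n
  C0≡n = trans (cong c (+-identityʳ ρ))
               (trans (sym (lookup≡kupAt (kupisch A) (proj₁ unique))) (proj₁ (proj₂ unique)))

  n≤C : ∀ y → n ≤ C y
  n≤C y = sincere⇒n≤ A sincere (ρ + y)

  n<C : ∀ y → 0 < y → y < n → n < C y
  n<C y 0<y y<n = ≤∧≢⇒< (n≤C y) λ n≡C → <⇒≢ 0<y (sym (y≡0 (sym n≡C)))
    where
    open ≡-Reasoning
    y≡0 : C y ≡ n → y ≡ 0
    y≡0 C≡n = trans (sym (m<n⇒m%n≡m y<n)) (%-cancel-+ˡ ρ n (begin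
      (ρ + y) % n          ≡⟨ toℕ-mod (ρ + y) ⟨
      toℕ ((ρ + y) mod n)  ≡⟨ cong toℕ (proj₂ (proj₂ unique) _ C≡n) ⟩
      ρ                    ≡⟨ m<n⇒m%n≡m (toℕ<n (proj₁ unique)) ⟨
      ρ % n                ≡⟨ cong (_% n) (+-identityʳ ρ) ⟨
      (ρ + 0) % n          ∎))

  C-periodic : ∀ y → C (y + n) ≡ C y
  C-periodic y = trans (cong c (sym (+-assoc ρ y n))) (kupAt-periodic (kupisch A) (ρ + y))

  C-mod : ∀ y → C y ≡ C (y % n)
  C-mod y = kupAt-cong (kupisch A) (ρ + y) (ρ + y % n) (sym (%-cong-+ˡ ρ n (m%n%n≡m%n y n)))

  C-step : ∀ y → C y ≤ suc (C (suc y))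
  C-step y = subst (λ x → C y ≤ suc (c x)) (sym (+-suc ρ y)) (sincere⇒kupisch-step A sincere (ρ + y))

  H : ℕ → ℕ
  H y = y + C y ∸ n

  +C≡n+H : ∀ y → y + C y ≡ n + H y
  +C≡n+H y = sym (m+[n∸m]≡n (≤-trans (n≤C y) (m≤n+m (C y) y)))

  H0≡0 : H 0 ≡ 0
  H0≡0 = trans (cong (_∸ n) C0≡n) (n∸n≡0 n)

  Hn≡n : H n ≡ n
  Hn≡n = trans (cong (λ z → n + z ∸ n) (trans (C-periodic 0) C0≡n)) (m+n∸n≡m n n)

  H-mono : ∀ {y y′} → y ≤ y′ → H y ≤ H y′
  H-mono {y} {y′} y≤y′ with m≤n⇒m<n∨m≡n y≤y′
  H-mono {y} {suc y′} _ | inj₁ (s≤s y≤y′) = ≤-trans (H-mono y≤y′)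
    (∸-monoˡ-≤ n (≤-trans (+-monoʳ-≤ y′ (C-step y′)) (≤-reflexive (+-suc y′ _))))
  ... | inj₂ refl = ≤-refl

  y≤H : ∀ y → y ≤ H y
  y≤H y = subst (_≤ H y) (m+n∸n≡m y n) (∸-monoˡ-≤ n (+-monoʳ-≤ y (n≤C y)))

  y<H : ∀ y → 0 < y → y < n → y < H y
  y<H y 0<y y<n = subst (_≤ H y) (m+n∸n≡m (suc y) n)
    (∸-monoˡ-≤ n (≤-trans (≤-reflexive (sym (+-suc y n))) (+-monoʳ-≤ y (n<C y 0<y y<n))))

  H≤n : ∀ y → y ≤ n → H y ≤ n
  H≤n y y≤n = subst (H y ≤_) Hn≡n (H-mono y≤n)

  iterate-mono : ∀ j {u v} → u ≤ v → iterate H u j ≤ iterate H v j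
  iterate-mono zero    u≤v = u≤v
  iterate-mono (suc j) u≤v = iterate-mono j (H-mono u≤v)

  iterate-≤n : ∀ j v → v ≤ n → iterate H v j ≤ n
  iterate-≤n zero    v v≤n = v≤n
  iterate-≤n (suc j) v v≤n = iterate-≤n j (H v) (H≤n v v≤n)

  iterate-n : ∀ j → iterate H n j ≡ n
  iterate-n zero    = refl
  iterate-n (suc j) = trans (cong (λ y → iterate H y j) Hn≡n) (iterate-n j)

  iterate-1≡n⇒iterate≡n : ∀ d → iterate H 1 d ≡ n → ∀ t → 0 < t → t ≤ n → iterate H t d ≡ n
  iterate-1≡n⇒iterate≡n d reach t 0<t t≤n =
    ≤-antisym (iterate-≤n d t t≤n) (subst (_≤ iterate H t d) reach (iterate-mono d 0<t))

  iterate≡n-within : ∀ j y → 0 < y → y ≤ n → n ≤ j + y → iterate H y j ≡ n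
  iterate≡n-within zero    y _   y≤n n≤y = ≤-antisym y≤n n≤y
  iterate≡n-within (suc j) y 0<y y≤n n≤ with y ≟ n
  ... | yes refl = iterate-n (suc j)
  ... | no  y≢n  = iterate≡n-within j (H y) (<-≤-trans 0<y (y≤H y)) (H≤n y y≤n)
      (≤-trans n≤ (≤-trans (≤-reflexive (sym (+-suc j y))) (+-monoʳ-≤ j (y<H y 0<y (≤∧≢⇒< y≤n y≢n)))))

  -- PdSeg d s t: the module with composition factors S_{ρ+s}, …, S_{ρ+t−1} has pd ≤ d
  PdSeg : ℕ → ℕ → ℕ → Set
  PdSeg d s t = PdLe A d (ρ + s) (t ∸ s)

  projective-seg : ∀ s → PdSeg 0 s (n + H s)
  projective-seg s = trans (cong (_∸ s) (sym (+C≡n+H s))) (m+n∸m≡n s (C s))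

  syzygy-top : ∀ {s t} → s ≤ t → ρ + s + (t ∸ s) ≡ ρ + t
  syzygy-top {s} {t} s≤t = trans (+-assoc ρ s (t ∸ s)) (cong (ρ +_) (m+[n∸m]≡n s≤t))

  syzygy-length : ∀ {s t} → s ≤ t → C s ∸ (t ∸ s) ≡ n + H s ∸ t
  syzygy-length {s} {t} s≤t = begin
    C s ∸ (t ∸ s)            ≡⟨ [m+n]∸[m+o]≡n∸o s (C s) (t ∸ s) ⟨
    s + C s ∸ (s + (t ∸ s))  ≡⟨ cong (s + C s ∸_) (m+[n∸m]≡n s≤t) ⟩
    s + C s ∸ t              ≡⟨ cong (_∸ t) (+C≡n+H s) ⟩
    n + H s ∸ t              ∎
    where open ≡-Reasoning

  syzygy-seg : ∀ d {s t} → s ≤ t → PdSeg d t (n + H s) → PdSeg (suc d) s t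
  syzygy-seg d s≤t pd = inj₂ (subst₂ (PdLe A d) (sym (syzygy-top s≤t)) (sym (syzygy-length s≤t)) pd)

  syzygy-seg⁻¹ : ∀ d {s t} → s ≤ t → PdSeg (suc d) s t → (t ∸ s ≡ C s) ⊎ PdSeg d t (n + H s)
  syzygy-seg⁻¹ d s≤t = Sum.map₂ (subst₂ (PdLe A d) (syzygy-top s≤t) (syzygy-length s≤t))

  shift-top : ∀ s → (ρ + s) % n ≡ (ρ + (n + s)) % n
  shift-top s = %-cong-+ˡ ρ n (sym (trans (cong (_% n) (+-comm n s)) ([m+n]%n≡m%n s n)))

  shift-seg : ∀ d {s t} → PdSeg d s t → PdSeg d (n + s) (n + t)
  shift-seg d {s} {t} pd = subst (PdLe A d (ρ + (n + s))) (sym ([m+n]∸[m+o]≡n∸o n t s))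
    (PdLe-cong A d (ρ + s) (ρ + (n + s)) (t ∸ s) (shift-top s) pd)

  shift-seg⁻¹ : ∀ d {s t} → PdSeg d (n + s) (n + t) → PdSeg d s t
  shift-seg⁻¹ d {s} {t} pd = PdLe-cong A d (ρ + (n + s)) (ρ + s) (t ∸ s) (sym (shift-top s))
    (subst (PdLe A d (ρ + (n + s))) ([m+n]∸[m+o]≡n∸o n t s) pd)

  second-syzygy-seg : ∀ d {s t} → s ≤ t → t ≤ n + H s → PdSeg d (H s) (H t) → PdSeg (2 + d) s t
  second-syzygy-seg d s≤t t≤ pd = syzygy-seg (suc d) s≤t (syzygy-seg d t≤ (shift-seg d pd))

  PdSeg-from-0 : ∀ j t → t ≤ n → iterate H t j ≡ n → PdSeg (2 * j) 0 t
  PdSeg-from-0 zero    t _   t≡n   = trans t≡n (sym C0≡n)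
  PdSeg-from-0 (suc j) t t≤n reach = subst (λ d → PdSeg d 0 t) (sym (*-suc 2 j))
    (second-syzygy-seg (2 * j) z≤n (≤-trans t≤n (m≤m+n n (H 0)))
      (subst (λ h → PdSeg (2 * j) h (H t)) (sym H0≡0) (PdSeg-from-0 j (H t) (H≤n t t≤n) reach)))

  PdSeg-inner : ∀ j {u v} → u ≤ v → v ≤ n → iterate H u (suc j) ≡ n → PdSeg (suc (2 * j)) u v
  PdSeg-inner zero {u} {v} u≤v v≤n reach =
    syzygy-seg 0 u≤v (subst (λ h → PdSeg 0 v (n + h)) (sym Hu≡Hv) (projective-seg v))
    where
    Hu≡Hv : H u ≡ H v
    Hu≡Hv = ≤-antisym (H-mono u≤v) (subst (H v ≤_) (sym reach) (H≤n v v≤n))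
  PdSeg-inner (suc j) {u} {v} u≤v v≤n reach = subst (λ d → PdSeg (suc d) u v) (sym (*-suc 2 j))
    (second-syzygy-seg (suc (2 * j)) u≤v (≤-trans v≤n (m≤m+n n (H u)))
      (PdSeg-inner j (H-mono u≤v) (H≤n v v≤n) reach))

  PdSeg-wrapping : ∀ d {s t} → 0 < s → s < n → s ≤ t → n < t → t ≤ s + C s →
                   iterate H 1 (suc d) ≡ n → PdSeg (suc (suc (2 * d))) s t
  PdSeg-wrapping d {s} {t} 0<s s<n s≤t n<t t≤ reach = syzygy-seg (suc (2 * d)) s≤t
    (subst (λ z → PdSeg (suc (2 * d)) z (n + H s)) n+u≡t
      (shift-seg _ (PdSeg-inner d u≤Hs (H≤n s (<⇒≤ s<n))
        (iterate-1≡n⇒iterate≡n (suc d) reach u (m<n⇒0<n∸m n<t) (≤-trans u≤Hs (H≤n s (<⇒≤ s<n)))))))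
    where
    u : ℕ
    u = t ∸ n
    n+u≡t : n + u ≡ t
    n+u≡t = m+[n∸m]≡n (<⇒≤ n<t)
    u≤Hs : u ≤ H s
    u≤Hs = +-cancelˡ-≤ n u (H s) (subst₂ _≤_ (sym n+u≡t) (+C≡n+H s) t≤)

  PdSeg-all : ∀ d → iterate H 1 d ≡ n → ∀ s t → s < n → s < t → t ≤ s + C s → PdSeg (2 * d) s t
  PdSeg-all d reach zero t _ 0<t t≤C =
    PdSeg-from-0 d t t≤n (iterate-1≡n⇒iterate≡n d reach t 0<t t≤n)
    where
    t≤n : t ≤ n
    t≤n = subst (t ≤_) C0≡n t≤C
  PdSeg-all zero reach (suc s) t s<n _ _ =
    ⊥-elim (1+n≰n (≤-trans (s≤s (s≤s z≤n)) (≤-trans s<n (≤-reflexive (sym reach)))))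
  PdSeg-all (suc d) reach (suc s) t s<n s<t t≤ = subst (λ e → PdSeg e (suc s) t) (sym (*-suc 2 d)) pd
    where
    pd : PdSeg (suc (suc (2 * d))) (suc s) t
    pd with t ≤? n
    ... | yes t≤n = PdLe-suc A _ _ _ (PdSeg-inner d (<⇒≤ s<t) t≤n
                      (iterate-1≡n⇒iterate≡n (suc d) reach (suc s) z<s (<⇒≤ s<n)))
    ... | no  t≰n = PdSeg-wrapping d z<s s<n (<⇒≤ s<t) (≰⇒> t≰n) t≤ reach

  allPdLe : ∀ d → iterate H 1 d ≡ n → AllPdLe A (2 * d)
  allPdLe d reach i l 0<l l≤c = PdLe-cong A (2 * d) (ρ + s) (toℕ i) l top≡
    (subst (PdLe A (2 * d) (ρ + s)) (m+n∸m≡n s l)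
      (PdSeg-all d reach s (s + l) (m%n<n (toℕ i + n ∸ ρ) n) (m<m+n s 0<l) (+-monoʳ-≤ s l≤C)))
    where
    open ≡-Reasoning
    s : ℕ
    s = (toℕ i + n ∸ ρ) % n
    top≡ : (ρ + s) % n ≡ toℕ i % n
    top≡ = begin
      (ρ + s) % n                ≡⟨ %-cong-+ˡ ρ n (m%n%n≡m%n (toℕ i + n ∸ ρ) n) ⟩
      (ρ + (toℕ i + n ∸ ρ)) % n  ≡⟨ cong (_% n) (m+[n∸m]≡n (≤-trans (<⇒≤ (toℕ<n (proj₁ unique)))
                                                                     (m≤n+m n (toℕ i)))) ⟩
      (toℕ i + n) % n            ≡⟨ [m+n]%n≡m%n (toℕ i) n ⟩
      toℕ i % n                  ∎
    l≤C : l ≤ C s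
    l≤C = subst (l ≤_) (kupAt-cong (kupisch A) (toℕ i) (ρ + s) (sym top≡)) l≤c

  finite : FiniteGlDim A
  finite = 2 * n , allPdLe n (iterate≡n-within n 1 z<s (s≤s z≤n) (m≤m+n n 1))

  initial-not-projective : ∀ {t} → t < n → t ≢ C 0
  initial-not-projective t<n t≡C = <⇒≢ t<n (trans t≡C C0≡n)

  next-not-projective : ∀ {t} → 0 < t → t < n → n + H 0 ∸ t ≢ C t
  next-not-projective {t} 0<t t<n len≡C = <⇒≱ (n<C t 0<t t<n)
    (subst (_≤ n) len≡C (≤-trans (m∸n≤m (n + H 0) t)
                                 (≤-reflexive (trans (cong (n +_) H0≡0) (+-identityʳ n)))))

  PdSeg-from-0⇒hit   : ∀ d t → 0 < t → t ≤ n → PdSeg d 0 t → ∃ λ j → 2 * j ≤ d × iterate H t j ≡ n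
  PdSeg-from-0⇒hit-< : ∀ d t → 0 < t → t < n → PdSeg d 0 t → ∃ λ j → 2 * j ≤ d × iterate H t j ≡ n

  PdSeg-from-0⇒hit d t 0<t t≤n pd with t ≟ n
  ... | yes t≡n = 0 , z≤n , t≡n
  ... | no  t≢n = PdSeg-from-0⇒hit-< d t 0<t (≤∧≢⇒< t≤n t≢n) pd

  PdSeg-from-0⇒hit-< zero t _ t<n proj = ⊥-elim (initial-not-projective t<n proj)
  PdSeg-from-0⇒hit-< (suc d) t 0<t t<n pd with syzygy-seg⁻¹ d z≤n pd
  ... | inj₁ proj = ⊥-elim (initial-not-projective t<n proj)
  PdSeg-from-0⇒hit-< (suc zero)    t 0<t t<n _ | inj₂ proj = ⊥-elim (next-not-projective 0<t t<n proj)
  PdSeg-from-0⇒hit-< (suc (suc d)) t 0<t t<n _ | inj₂ pd₁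
    with syzygy-seg⁻¹ d (≤-trans (<⇒≤ t<n) (m≤m+n n (H 0))) pd₁
  ... | inj₁ proj = ⊥-elim (next-not-projective 0<t t<n proj)
  ... | inj₂ pd₂ with PdSeg-from-0⇒hit d (H t) (<-≤-trans 0<t (y≤H t)) (H≤n t (<⇒≤ t<n))
                        (subst (λ h → PdSeg d h (H t)) H0≡0 (shift-seg⁻¹ d pd₂))
  ...   | j , 2j≤d , reach = suc j , subst (_≤ 2 + d) (sym (*-suc 2 j)) (s≤s (s≤s 2j≤d)) , reach

  glDimIs-hitting : ∀ d → iterate H 1 d ≡ n → (∀ t → t < d → iterate H 1 t < n) → GlDimIs A (2 * d)
  glDimIs-hitting d reach below = allPdLe d reach , minimal
    where
    simple : ∀ d′ → AllPdLe A d′ → PdSeg d′ 0 1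
    simple d′ allPd = subst (λ x → PdLe A d′ x 1) (sym (+-identityʳ ρ))
      (allPd (proj₁ unique) 1 z<s (≤-trans (s≤s z≤n) (sincere⇒n≤ A sincere ρ)))
    minimal : ∀ d′ → AllPdLe A d′ → 2 * d ≤ d′
    minimal d′ allPd with PdSeg-from-0⇒hit d′ 1 z<s (s≤s z≤n) (simple d′ allPd)
    ... | j , 2j≤d′ , reach-j = ≤-trans (*-monoʳ-≤ 2 (≮⇒≥ λ j<d → <⇒≢ (below j j<d) reach-j)) 2j≤d′

  profile : ℕ → ℕ
  profile j = C (suc j) ∸ n

  areaProfile : AreaProfile m profile
  areaProfile = record
    { positive = λ j j<m → m<n⇒0<n∸m (n<C (suc j) z<s (s≤s j<m))
    ; final    = trans (cong (_∸ n) (trans (C-periodic 0) C0≡n)) (n∸n≡0 n)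
    ; descent  = λ j _ → ≤-trans (∸-monoˡ-≤ n (C-step (suc j))) (≤-reflexive (+-∸-assoc 1 (n≤C (suc (suc j)))))
    }

  glDimIs-bounce : ∀ {a d} → (∀ j → j < m → a j ≡ suc (profile j)) → BounceCountOf m a d → GlDimIs A (2 * d)
  glDimIs-bounce {a} {d} a≡ (b , b0≡0 , bounce , bd≡m) =
    glDimIs-hitting d (trans (iterate≡ d ≤-refl) (cong suc bd≡m))
      λ t t<d → subst (_< n) (sym (iterate≡ t (<⇒≤ t<d))) (s≤s (proj₁ (bounce t t<d)))
    where
    iterate≡ : ∀ t → t ≤ d → iterate H 1 t ≡ suc (b t)
    iterate≡ zero    _   = cong suc (sym b0≡0)
    iterate≡ (suc t) t<d = begin
      iterate H 1 (suc t)                  ≡⟨ iterate-suc H 1 t ⟩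
      H (iterate H 1 t)                    ≡⟨ cong H (iterate≡ t (<⇒≤ t<d)) ⟩
      H (suc (b t))                        ≡⟨ +-∸-assoc (suc (b t)) (n≤C (suc (b t))) ⟩
      suc (b t + profile (b t))            ≡⟨ cong (λ x → suc (x ∸ 1)) (+-suc (b t) (profile (b t))) ⟨
      suc (b t + suc (profile (b t)) ∸ 1)  ≡⟨ cong (λ x → suc (b t + x ∸ 1)) (a≡ (b t) (proj₁ (bounce t t<d))) ⟨
      suc (b t + a (b t) ∸ 1)              ≡⟨ cong suc (proj₂ (bounce t t<d)) ⟨
      suc (b (suc t))                      ∎
      where open ≡-Reasoning

  hasProfile⇒corresponds : (D : DyckPath m) → HasProfile D profile → Corresponds A D
  hasProfile⇒corresponds D hp = proj₁ unique , proj₁ (proj₂ unique)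
    , (λ j j<m → subst (AreaEntry D j) (+-comm 1 (profile j)) (hp j (<⇒≤ j<m)))
    , subst (λ b → AreaEntry D m (suc b)) (AreaProfile.final areaProfile) (hp m ≤-refl)

  corresponds⇒hasProfile : (D : DyckPath m) → Corresponds A D → HasProfile D profile
  corresponds⇒hasProfile D (r , cr≡n , entries , last) j j≤m with m≤n⇒m<n∨m≡n j≤m
  ... | inj₁ j<m  = subst (AreaEntry D j) (+-comm (profile j) 1)
      (subst (λ r → AreaEntry D j (c (toℕ r + suc j) ∸ n + 1)) (proj₂ (proj₂ unique) r cr≡n) (entries j j<m))
  ... | inj₂ refl = subst (λ b → AreaEntry D m (suc b)) (sym (AreaProfile.final areaProfile)) last

-- The correspondence

module CyclicAlgebraOfProfile {m : ℕ} {b : ℕ → ℕ} (prof : AreaProfile (suc m) b) where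
  open AreaProfile prof
  private
    n : ℕ
    n = suc (suc m)

  dims : ℕ → ℕ
  dims zero    = n
  dims (suc j) = b j + n

  kupischSeries : Vec ℕ n
  kupischSeries = tabulate (λ i → dims (toℕ i))

  lookup-kupischSeries : ∀ i → lookup kupischSeries i ≡ dims (toℕ i)
  lookup-kupischSeries i = lookup∘tabulate (λ i → dims (toℕ i)) i

  kupAt-kupischSeries : ∀ x → kupAt kupischSeries x ≡ dims (x % n)
  kupAt-kupischSeries x = trans (lookup-kupischSeries (x mod n)) (cong dims (toℕ-mod x))

  n≤dims : ∀ y → n ≤ dims y
  n≤dims zero    = ≤-refl
  n≤dims (suc j) = m≤n+m n (b j)

  dims-step : ∀ y → y < n → dims y ≤ suc (dims (suc y % n))
  dims-step y y<n with suc y <? n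
  ... | yes sy<n = subst (λ z → dims y ≤ suc (dims z)) (sym (m<n⇒m%n≡m sy<n)) (inside y sy<n)
    where
    inside : ∀ y → suc y < n → dims y ≤ suc (dims (suc y))
    inside zero    _           = ≤-trans (m≤n+m n (b 0)) (n≤1+n _)
    inside (suc j) (s≤s sj<sm) = +-monoˡ-≤ n (descent j (≤-trans (n≤1+n _) sj<sm))
  ... | no sy≮n with ≤-antisym (≤-pred y<n) (≤-pred (≮⇒≥ sy≮n))
  ...   | refl = subst (λ z → dims (suc m) ≤ suc (dims z)) (sym (n%n≡0 n))
                   (+-monoˡ-≤ n (≤-trans (descent m ≤-refl) (s≤s (≤-reflexive final))))

  algebra : Nakayama (suc m)
  algebra = record { kind = cyclic ; kupisch = kupischSeries ; valid = kupischSeries-valid }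
    where
    kupischSeries-valid : ValidKupisch cyclic kupischSeries
    kupischSeries-valid i =
        subst (2 ≤_) (sym (lookup-kupischSeries i)) (≤-trans (s≤s (s≤s z≤n)) (n≤dims (toℕ i)))
      , subst₂ (λ x y → x ≤ suc y) (sym (lookup-kupischSeries i)) (sym (kupAt-kupischSeries (suc (toℕ i))))
               (dims-step (toℕ i) (toℕ<n i))

  sincere : Sincere algebra
  sincere = n≤⇒sincere algebra λ i → subst (n ≤_) (sym (lookup-kupischSeries i)) (n≤dims (toℕ i))

  unique : UniqueProjOfDim algebra n
  unique = fzero , refl , only-fzero
    where
    only-fzero : ∀ j → lookup kupischSeries j ≡ n → j ≡ fzero
    only-fzero fzero    _   = refl
    only-fzero (fsuc j) d≡n = ⊥-elim (<⇒≢ (positive (toℕ j) (toℕ<n j))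
      (sym (+-cancelʳ-≡ n (b (toℕ j)) 0 (trans (sym (lookup-kupischSeries (fsuc j))) d≡n))))

  profile≡ : ∀ j → j ≤ suc m → b j ≡ MinimalProjective.profile algebra sincere unique j
  profile≡ j j≤sm with m≤n⇒m<n∨m≡n j≤sm
  ... | inj₁ j<sm = sym (trans (cong (_∸ n) (trans (kupAt-kupischSeries (suc j))
                                                   (cong dims (m<n⇒m%n≡m (s≤s j<sm)))))
                               (m+n∸n≡m (b j) n))
  ... | inj₂ refl = trans final (sym (trans (cong (_∸ n) (trans (kupAt-kupischSeries n) (cong dims (n%n≡0 n))))
                                            (n∸n≡0 n)))

algebraOf : ∀ {m b} → AreaProfile m b →
  Σ (Nakayama m) λ A → Σ (Sincere A) λ s → Σ (UniqueProjOfDim A (suc m)) λ u →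
    ∀ j → j ≤ m → b j ≡ MinimalProjective.profile A s u j
algebraOf {zero} prof = K , sincere , unique , λ { zero _ → AreaProfile.final prof }
  where
  K : Nakayama 0
  K = record { kind = linear ; kupisch = 1 ∷ [] ; valid = (λ _ ()) , refl }
  sincere : Sincere K
  sincere = n≤⇒sincere K λ { fzero → ≤-refl }
  unique : UniqueProjOfDim K 1
  unique = fzero , refl , λ { fzero _ → refl }
algebraOf {suc m} prof = algebra , sincere , unique , profile≡
  where open CyclicAlgebraOfProfile prof

module _ {m : ℕ} where
  private
    n : ℕ
    n = suc m

  corresponds-rotate : (A B : Nakayama m) (D : DyckPath m) (cA : Corresponds A D) (r′ : ℕ) →
    (∀ y → c[ B ] (r′ + y) ≡ c[ A ] (toℕ (proj₁ cA) + y)) → Corresponds B D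
  corresponds-rotate A B D (r , cr≡n , entries , last) r′ rotate = r′ mod n , cr′≡n , entries′ , last
    where
    open ≡-Reasoning
    cr′≡n : c[ B ] r′ ≡ n
    cr′≡n = begin
      c[ B ] r′             ≡⟨ cong c[ B ] (+-identityʳ r′) ⟨
      c[ B ] (r′ + 0)       ≡⟨ rotate 0 ⟩
      c[ A ] (toℕ r + 0)    ≡⟨ cong c[ A ] (+-identityʳ (toℕ r)) ⟩
      c[ A ] (toℕ r)        ≡⟨ lookup≡kupAt (kupisch A) r ⟨
      lookup (kupisch A) r  ≡⟨ cr≡n ⟩
      n                     ∎
    top≡ : ∀ j → (toℕ (r′ mod n) + suc j) % n ≡ (r′ + suc j) % n
    top≡ j = %-cong-+ʳ {toℕ (r′ mod n)} {r′} (suc j) n (trans (cong (_% n) (toℕ-mod r′)) (m%n%n≡m%n r′ n))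
    entries′ : ∀ j → j < m → AreaEntry D j (c[ B ] (toℕ (r′ mod n) + suc j) ∸ n + 1)
    entries′ j j<m = subst (λ x → AreaEntry D j (x ∸ n + 1))
      (sym (trans (kupAt-cong (kupisch B) (toℕ (r′ mod n) + suc j) (r′ + suc j) (top≡ j)) (rotate (suc j))))
      (entries j j<m)

  iso-corresponds : (A B : Nakayama m) (D : DyckPath m) → Iso A B → Corresponds A D → Corresponds B D
  iso-corresponds A B D (inj₁ (_ , _ , v≡)) cA =
    corresponds-rotate A B D cA (toℕ (proj₁ cA)) λ y → cong (λ v → kupAt v (toℕ (proj₁ cA) + y)) (sym v≡)
  iso-corresponds A B D (inj₂ (_ , _ , s , rotate)) cA = corresponds-rotate A B D cA r′ λ y →
    trans (sym (rotate (r′ + y))) (kupAt-cong (kupisch A) (s + (r′ + y)) (r + y) (trans (cong (_% n) (begin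
      s + (r′ + y)   ≡⟨ +-assoc s r′ y ⟨
      s + r′ + y     ≡⟨ cong (_+ y) (m+[n∸m]≡n s≤) ⟩
      r + s * n + y  ≡⟨ xy∙z≈xz∙y r (s * n) y ⟩
      r + y + s * n  ∎)) ([m+kn]%n≡m%n (r + y) s n)))
    where
    open ≡-Reasoning
    r : ℕ
    r = toℕ (proj₁ cA)
    -- s + r′ = r + s n: rotating back by s without truncated subtraction
    r′ : ℕ
    r′ = r + s * n ∸ s
    s≤ : s ≤ r + s * n
    s≤ = ≤-trans (m≤m*n s n) (m≤n+m (s * n) r)

corresponds-injective : ∀ {m} (A B : Nakayama m) (D : DyckPath m) →
  Sincere A → FiniteGlDim A → Sincere B → FiniteGlDim B → Corresponds A D → Corresponds B D → Iso A B
corresponds-injective {zero} A B D sA fA sB fB (fzero , cA≡1 , _) (fzero , cB≡1 , _) =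
  inj₁ ( finite-linear A sA fA , finite-linear B sB fB
       , singleton-≡ (kupisch A) (kupisch B) (trans cA≡1 (sym cB≡1)))
  where
  singleton-≡ : (v w : Vec ℕ 1) → lookup v fzero ≡ lookup w fzero → v ≡ w
  singleton-≡ (x ∷ []) (y ∷ []) x≡y = cong (_∷ []) x≡y
corresponds-injective {suc m} A B D sA fA sB fB cA cB =
  inj₂ (sincere-cyclic A sA , sincere-cyclic B sB , α.ρ + (n ∸ β.ρ) , rotate)
  where
  open ≡-Reasoning
  module α = MinimalProjective A sA (finite⇒unique A sA fA)
  module β = MinimalProjective B sB (finite⇒unique B sB fB)
  n : ℕ
  n = suc (suc m)
  C≡<n : ∀ y → y < n → α.C y ≡ β.C y
  C≡<n zero    _          = trans α.C0≡n (sym β.C0≡n)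
  C≡<n (suc j) (s≤s j<sm) = begin
    α.C (suc j)          ≡⟨ m∸n+n≡m (α.n≤C (suc j)) ⟨
    α.C (suc j) ∸ n + n  ≡⟨ cong (_+ n) (suc-injective (areaEntry-unique D j
                              (α.corresponds⇒hasProfile D cA j (<⇒≤ j<sm))
                              (β.corresponds⇒hasProfile D cB j (<⇒≤ j<sm)))) ⟩
    β.C (suc j) ∸ n + n  ≡⟨ m∸n+n≡m (β.n≤C (suc j)) ⟩
    β.C (suc j)          ∎
  ρB≤n : β.ρ ≤ n
  ρB≤n = <⇒≤ (toℕ<n (proj₁ (finite⇒unique B sB fB)))
  C≡ : ∀ y → α.C y ≡ β.C y
  C≡ y = trans (α.C-mod y) (trans (C≡<n (y % n) (m%n<n y n)) (sym (β.C-mod y)))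
  rotate : ∀ i → c[ A ] (α.ρ + (n ∸ β.ρ) + i) ≡ c[ B ] i
  rotate i = begin
    c[ A ] (α.ρ + (n ∸ β.ρ) + i)  ≡⟨ cong c[ A ] (+-assoc α.ρ (n ∸ β.ρ) i) ⟩
    α.C (n ∸ β.ρ + i)             ≡⟨ C≡ (n ∸ β.ρ + i) ⟩
    c[ B ] (β.ρ + (n ∸ β.ρ + i))  ≡⟨ cong c[ B ] (+-assoc β.ρ (n ∸ β.ρ) i) ⟨
    c[ B ] (β.ρ + (n ∸ β.ρ) + i)  ≡⟨ cong (λ x → c[ B ] (x + i)) (m+[n∸m]≡n ρB≤n) ⟩
    c[ B ] (n + i)                ≡⟨ cong c[ B ] (+-comm n i) ⟩
    c[ B ] (i + n)                ≡⟨ kupAt-periodic (kupisch B) i ⟩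
    c[ B ] i                      ∎

dyckPathOf : ∀ {m} (A : Nakayama m) → Sincere A → FiniteGlDim A → Σ (DyckPath m) (Corresponds A)
dyckPathOf A sincere finite = dyckPath areaProfile , hasProfile⇒corresponds _ (hasProfile areaProfile)
  where
  open MinimalProjective A sincere (finite⇒unique A sincere finite)
  open PathFromProfile profile using (dyckPath; hasProfile)

corresponds-unique : ∀ {m} (A : Nakayama m) (D D′ : DyckPath m) → Sincere A → FiniteGlDim A →
  Corresponds A D → Corresponds A D′ → steps D ≡ steps D′
corresponds-unique A D D′ sincere finite cD cD′ =
  hasProfile-unique D D′ (corresponds⇒hasProfile D cD) (corresponds⇒hasProfile D′ cD′)
  where open MinimalProjective A sincere (finite⇒unique A sincere finite)

nakayamaOf : ∀ {m} (D : DyckPath m) → Σ (Nakayama m) λ A → Sincere A × FiniteGlDim A × Corresponds A D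
nakayamaOf D with algebraOf (DyckPathProfile.areaProfile D)
... | A , sincere , unique , profile≡ =
  A , sincere , finite , hasProfile⇒corresponds D (hasProfile-cong D profile≡ (DyckPathProfile.hasProfile D))
  where open MinimalProjective A sincere unique

glDim≡2*bounceCount : ∀ {m} (A : Nakayama m) (D : DyckPath m) (d : ℕ) → Sincere A → FiniteGlDim A →
  Corresponds A D → BounceCount D d → GlDimIs A (2 * d)
glDim≡2*bounceCount A D d sincere finite cD (a , isArea , bounce) = glDimIs-bounce (λ j j<m →
  areaEntry-unique D j (isArea j (<⇒≤ j<m)) (corresponds⇒hasProfile D cD j (<⇒≤ j<m))) bounce
  where open MinimalProjective A sincere (finite⇒unique A sincere finite)

theorem4p7 : (m : ℕ) →
    ((A : Nakayama m) → Sincere A →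
      (FiniteGlDim A → UniqueProjOfDim A (suc m)) × (UniqueProjOfDim A (suc m) → FiniteGlDim A))
    × ((A : Nakayama m) → Sincere A → FiniteGlDim A → Σ (DyckPath m) (λ D → Corresponds A D))
    × ((A : Nakayama m) (D D' : DyckPath m) → Sincere A → FiniteGlDim A →
      Corresponds A D → Corresponds A D' → steps D ≡ steps D')
    × ((A B : Nakayama m) (D : DyckPath m) → Iso A B → Corresponds A D → Corresponds B D)
    × ((A B : Nakayama m) (D : DyckPath m) → Sincere A → FiniteGlDim A → Sincere B → FiniteGlDim B →
      Corresponds A D → Corresponds B D → Iso A B)
    × ((D : DyckPath m) → Σ (Nakayama m) (λ A → Sincere A × FiniteGlDim A × Corresponds A D))
    × ((A : Nakayama m) (D : DyckPath m) (d : ℕ) → Sincere A → FiniteGlDim A →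
      Corresponds A D → BounceCount D d → GlDimIs A (2 * d))
theorem4p7 m =
    (λ A sincere → finite⇒unique A sincere , MinimalProjective.finite A sincere)
  , dyckPathOf
  , corresponds-unique
  , iso-corresponds
  , corresponds-injective
  , nakayamaOf
  , glDim≡2*bounceCount
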